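{- A set $W \subseteq \mathbb{Z}$ is a minimal additive complement to itself if and only if $W + W = \mathbb{Z}$ and $W$ contains no 3-term arithmetic progression, i.e. there are no $w \in W$ and integer $d \neq 0$ with $w - d, w, w + d \in W$.
   Context: For $C, W \subseteq \mathbb{Z}$, $C + W = \{c + w : c \in C, w \in W\}$. $C$ is an additive complement to $W$ if $C + W = \mathbb{Z}$; it is a minimal additive complement to $W$ if moreover no proper subset of $C$ is an additive complement to $W$. -}

module Defs where

open import Level using (0ℓ)
open import Data.Integer using (ℤ; _+_; _-_; +_)
open import Data.Product using (Σ; ∃; _×_; _,_)
open import Relation.Binary.PropositionalEquality using (_≡_)
open import Relation.Nullary using (¬_)
open import Relation.Unary using (Pred; _∈_; _∉_; _⊆_)

_⊕_ : Pred ℤ 0ℓ → Pred ℤ 0ℓ → Pred ℤ 0ℓ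
(C ⊕ W) n = Σ ℤ λ c → Σ ℤ λ w → c ∈ C × w ∈ W × c + w ≡ n

IsAdditiveComplement : Pred ℤ 0ℓ → Pred ℤ 0ℓ → Set
IsAdditiveComplement C W = ∀ n → n ∈ (C ⊕ W)

_⊊_ : Pred ℤ 0ℓ → Pred ℤ 0ℓ → Set
C' ⊊ C = C' ⊆ C × (Σ ℤ λ x → x ∈ C × x ∉ C')

IsMinimalAdditiveComplement : Pred ℤ 0ℓ → Pred ℤ 0ℓ → Set₁
IsMinimalAdditiveComplement C W =
  IsAdditiveComplement C W ×
  (∀ (C' : Pred ℤ 0ℓ) → C' ⊊ C → ¬ IsAdditiveComplement C' W)

No3AP : Pred ℤ 0ℓ → Set
No3AP W = ∀ (w d : ℤ) → ¬ (d ≡ + 0) → ¬ ((w - d) ∈ W × w ∈ W × (w + d) ∈ W)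

{-# OPTIONS --safe #-}
module Submission where

-- Removing a point x from a complement C of W keeps it a complement as soon
-- as the translate x + W is still covered without x.  For C = W and x the
-- centre of a 3-term progression x - d, x, x + d, this holds: x + w with w ≠ x
-- is w + x, and x + x = (x - d) + (x + d); so minimality forbids progressions.
-- Conversely, if c + w = x + x with c ≠ x, then c, x, w is a progression with
-- difference x - c; so in a progression-free W the only representation of x + x
-- uses x itself, and no proper subset of W missing x can cover x + x.

open import Defs
open import Level using (0ℓ)
open import Data.Integer using (ℤ; _+_; _-_; +_)
open import Data.Integer.Properties using (_≟_; +-comm; +-inverseʳ; i-j≡0⇒i≡j)
open import Data.Integer.Tactic.RingSolver using (solve-∀)
open import Data.Product using (_×_; _,_; proj₁)
open import Function.Base using (_∘_)
open import Function.Bundles using (_⇔_; mk⇔)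
open import Relation.Unary using (Pred; _∈_; _∖_; ｛_｝)
open import Relation.Nullary using (¬_; yes; no; contradiction)
open import Relation.Binary.PropositionalEquality using (_≡_; refl; sym; cong; subst; module ≡-Reasoning)

private
  progression-sum : ∀ w d → (w - d) + (w + d) ≡ w + w
  progression-sum = solve-∀

  lower-end : ∀ x c → x - (x - c) ≡ c
  lower-end = solve-∀

  centre-difference : ∀ w d → w ≡ w - d → d ≡ + 0
  centre-difference w d w≡w-d = begin
    d            ≡⟨ sym (lower-end w d) ⟩
    w - (w - d)  ≡⟨ cong (w -_) (sym w≡w-d) ⟩
    w - w        ≡⟨ +-inverseʳ w ⟩
    + 0          ∎
    where open ≡-Reasoning

  upper-end : ∀ x c w → c + w ≡ x + x → x + (x - c) ≡ w
  upper-end x c w c+w≡x+x = begin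
    x + (x - c)  ≡⟨ regroup x c ⟩
    (x + x) - c  ≡⟨ cong (_- c) (sym c+w≡x+x) ⟩
    (c + w) - c  ≡⟨ cancel c w ⟩
    w            ∎
    where
    open ≡-Reasoning
    regroup : ∀ x c → x + (x - c) ≡ (x + x) - c
    regroup = solve-∀
    cancel : ∀ c w → (c + w) - c ≡ w
    cancel = solve-∀

∖｛｝-⊊ : ∀ {C : Pred ℤ 0ℓ} {x} → x ∈ C → (C ∖ ｛ x ｝) ⊊ C
∖｛｝-⊊ {x = x} x∈C = proj₁ , x , x∈C , λ (_ , x≢x) → x≢x refl

complement-∖｛｝ : ∀ {C W : Pred ℤ 0ℓ} {x} → IsAdditiveComplement C W →
                   (∀ {w} → w ∈ W → x + w ∈ (C ∖ ｛ x ｝) ⊕ W) →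
                   IsAdditiveComplement (C ∖ ｛ x ｝) W
complement-∖｛｝ {C} {W} {x} cover translate-covered n with cover n
... | c , w , c∈C , w∈W , c+w≡n with x ≟ c
...   | no x≢c  = c , w , (c∈C , x≢c) , w∈W , c+w≡n
...   | yes refl = subst ((C ∖ ｛ x ｝) ⊕ W) c+w≡n (translate-covered w∈W)

complement-∖progression-centre : ∀ {W : Pred ℤ 0ℓ} {x d} → IsAdditiveComplement W W →
                                  ¬ d ≡ + 0 → x - d ∈ W → x ∈ W → x + d ∈ W →
                                  IsAdditiveComplement (W ∖ ｛ x ｝) W
complement-∖progression-centre {W} {x} {d} cover d≢0 x-d∈W x∈W x+d∈W =
  complement-∖｛｝ cover translate-covered
  where
  translate-covered : ∀ {w} → w ∈ W → x + w ∈ (W ∖ ｛ x ｝) ⊕ W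
  translate-covered {w} w∈W with x ≟ w
  ... | no x≢w   = w , x , (w∈W , x≢w) , x∈W , +-comm w x
  ... | yes refl = x - d , x + d , (x-d∈W , d≢0 ∘ centre-difference x d) , x+d∈W , progression-sum x d

no3AP⇒double-representation-unique : ∀ {W : Pred ℤ 0ℓ} → No3AP W →
                                      ∀ {x c w} → x ∈ W → c ∈ W → w ∈ W → c + w ≡ x + x → c ≡ x
no3AP⇒double-representation-unique {W} no3 {x} {c} {w} x∈W c∈W w∈W c+w≡x+x with c ≟ x
... | yes c≡x = c≡x
... | no c≢x  = contradiction (lower∈W , x∈W , upper∈W) (no3 x (x - c) (c≢x ∘ sym ∘ i-j≡0⇒i≡j x c))
  where
  lower∈W : x - (x - c) ∈ W
  lower∈W = subst W (sym (lower-end x c)) c∈W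
  upper∈W : x + (x - c) ∈ W
  upper∈W = subst W (sym (upper-end x c w c+w≡x+x)) w∈W

theorem10 : (W : Pred ℤ 0ℓ) →
    IsMinimalAdditiveComplement W W ⇔ (IsAdditiveComplement W W × No3AP W)
theorem10 W = mk⇔ minimal⇒no3AP no3AP⇒minimal
  where
  minimal⇒no3AP : IsMinimalAdditiveComplement W W → IsAdditiveComplement W W × No3AP W
  minimal⇒no3AP (cover , minimal) = cover , λ x d d≢0 (x-d∈W , x∈W , x+d∈W) →
    minimal (W ∖ ｛ x ｝) (∖｛｝-⊊ x∈W)
      (complement-∖progression-centre cover d≢0 x-d∈W x∈W x+d∈W)

  no3AP⇒minimal : IsAdditiveComplement W W × No3AP W → IsMinimalAdditiveComplement W W
  no3AP⇒minimal (cover , no3) = cover , λ C (C⊆W , x , x∈W , x∉C) C-cover →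
    let (c , w , c∈C , w∈W , c+w≡x+x) = C-cover (x + x)
    in  x∉C (subst C (no3AP⇒double-representation-unique no3 x∈W (C⊆W c∈C) w∈W c+w≡x+x) c∈C)
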